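{- Let $x,y,v,u$ be vertices of a distance-hereditary graph $G$ with $v\in I(x,u)$, $u\in I(y,v)$ and $d_G(u,v)>1$. Then $d_G(x,y)=d_G(x,v)+d_G(v,u)+d_G(u,y)$.
   Context: Graphs are finite, connected, unweighted, undirected and simple; $d_G$ is shortest-path distance. The interval is $I(a,b)=\{w\mid d_G(a,b)=d_G(a,w)+d_G(w,b)\}$. A graph is distance-hereditary if distances in every connected induced subgraph equal distances in $G$. -}

module Defs where

open import Level using (0ℓ)
open import Data.Nat using (ℕ; zero; suc; _+_; _≤_; _<_)
open import Data.Fin using (Fin)
open import Data.Fin.Subset using (Subset; _∈_)
open import Data.Product using (Σ; ∃; _×_; _,_)
open import Data.Empty using (⊥)
open import Relation.Binary.PropositionalEquality using (_≡_)

record Graph (n : ℕ) : Set₁ where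
  field
    Adj   : Fin n → Fin n → Set
    sym   : ∀ {a b} → Adj a b → Adj b a
    irrefl : ∀ {a} → Adj a a → ⊥

module _ {n : ℕ} (G : Graph n) where
  open Graph G

  data Walk : Fin n → Fin n → ℕ → Set where
    here : ∀ {a} → Walk a a 0
    step : ∀ {a b c k} → Adj a b → Walk b c k → Walk a c (suc k)

  data WalkIn (S : Subset n) : Fin n → Fin n → ℕ → Set where
    here : ∀ {a} → a ∈ S → WalkIn S a a 0
    step : ∀ {a b c k} → a ∈ S → Adj a b → WalkIn S b c k → WalkIn S a c (suc k)

  Connected : Set
  Connected = ∀ a b → ∃ λ k → Walk a b k

  IsDist : Fin n → Fin n → ℕ → Set
  IsDist a b k = Walk a b k × (∀ m → Walk a b m → k ≤ m)

  ConnectedIn : Subset n → Set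
  ConnectedIn S = ∀ a b → a ∈ S → b ∈ S → ∃ λ k → WalkIn S a b k

  IsDistIn : Subset n → Fin n → Fin n → ℕ → Set
  IsDistIn S a b k = WalkIn S a b k × (∀ m → WalkIn S a b m → k ≤ m)

  DistanceHereditary : Set
  DistanceHereditary =
    ∀ (S : Subset n) → ConnectedIn S →
    ∀ a b k → a ∈ S → b ∈ S → IsDistIn S a b k → IsDist a b k

  InInterval : Fin n → Fin n → Fin n → Set
  InInterval a b w =
    ∃ λ dab → ∃ λ daw → ∃ λ dwb →
      IsDist a b dab × IsDist a w daw × IsDist w b dwb × (dab ≡ daw + dwb)

-- Let P, Q, R be geodesics x → v, v → u, u → y and S the vertex set of the walk P Q R.
-- Index every vertex of S by a position along P Q R. The hypotheses v ∈ I(x,u) and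
-- u ∈ I(y,v) say that P Q and Q R are geodesics, and from this one checks that
-- positions grow by at most one along each edge of G[S]: the only dangerous edges, from
-- P to R, would create a path x → u of length < d(x,v) + d(v,u) or v → y of length
-- < d(v,u) + d(u,y), because d(v,u) ≥ 2. Hence G[S] is a connected induced subgraph in
-- which d(x,y) = |P| + |Q| + |R|, and distance-heredity transfers this to G.
module Submission where

open import Defs
open import Data.Nat using (ℕ; suc; _+_; _<_; _≤_; z≤n; s≤s)
open import Data.Nat.Properties
open import Data.Nat.Tactic.RingSolver using (solve)
open import Data.List using (_∷_; [])
open import Data.Fin using (Fin)
open import Data.Fin.Subset using (Subset; _∈_; _⊆_; ⁅_⁆; _∪_)
open import Data.Fin.Subset.Properties using (x∈⁅x⁆; x∈⁅y⁆⇒x≡y; x∈p∪q⁻; x∈p∪q⁺; p⊆p∪q; q⊆p∪q)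
open import Data.Product using (∃; _×_; _,_; proj₁; proj₂)
open import Data.Sum using (_⊎_; inj₁; inj₂)
open import Data.Empty using (⊥; ⊥-elim)
open import Relation.Binary.PropositionalEquality

module Walks {n : ℕ} (G : Graph n) where
  open Graph G using (Adj) renaming (sym to Adj-sym)

  infixr 5 _++_ _++In_

  _∷ʳ_ : ∀ {a b c k} → Walk G a b k → Adj b c → Walk G a c (suc k)
  here       ∷ʳ e = step e here
  step e′ W ∷ʳ e = step e′ (W ∷ʳ e)

  reverse : ∀ {a b k} → Walk G a b k → Walk G b a k
  reverse here       = here
  reverse (step e W) = reverse W ∷ʳ Adj-sym e

  _++_ : ∀ {a b c k m} → Walk G a b k → Walk G b c m → Walk G a c (k + m)
  here     ++ W = W
  step e V ++ W = step e (V ++ W)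

  IsDist-sym : ∀ {a b k} → IsDist G a b k → IsDist G b a k
  IsDist-sym (W , shortest) = reverse W , λ m V → shortest m (reverse V)

  IsDist-unique : ∀ {a b k k′} → IsDist G a b k → IsDist G a b k′ → k ≡ k′
  IsDist-unique (W , shortest) (W′ , shortest′) = ≤-antisym (shortest _ W′) (shortest′ _ W)

  interval-dist : ∀ {a b w p q} → InInterval G a b w →
    IsDist G a w p → IsDist G w b q → IsDist G a b (p + q)
  interval-dist (_ , _ , _ , ab , aw , wb , d≡) aw′ wb′ =
    subst (IsDist G _ _) (trans d≡ (cong₂ _+_ (IsDist-unique aw aw′) (IsDist-unique wb wb′))) ab

  data Waypoint (s t : Fin n) (k : ℕ) (w : Fin n) (i : ℕ) : Set where
    waypoint : ∀ {j} → Walk G s w i → Walk G w t j → i + j ≡ k → Waypoint s t k w i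

  waypoint-≤ : ∀ {s t k w i} → Waypoint s t k w i → i ≤ k
  waypoint-≤ (waypoint {j} _ _ i+j≡k) = subst (_ ≤_) i+j≡k (m≤m+n _ j)

  support : ∀ {a b k} → Walk G a b k → Subset n
  support {a} here       = ⁅ a ⁆
  support {a} (step _ W) = ⁅ a ⁆ ∪ support W

  start∈support : ∀ {a b k} (W : Walk G a b k) → a ∈ support W
  start∈support {a} here       = x∈⁅x⁆ a
  start∈support {a} (step _ W) = p⊆p∪q (support W) (x∈⁅x⁆ a)

  ∈-support-++ : ∀ {a b c k m} (V : Walk G a b k) (W : Walk G b c m) {z} →
    z ∈ support (V ++ W) → z ∈ support V ⊎ z ∈ support W
  ∈-support-++ here       W z∈ = inj₂ z∈
  ∈-support-++ {a} (step _ V) W z∈ with x∈p∪q⁻ ⁅ a ⁆ (support (V ++ W)) z∈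
  ... | inj₁ z∈a  = inj₁ (x∈p∪q⁺ (inj₁ z∈a))
  ... | inj₂ z∈VW with ∈-support-++ V W z∈VW
  ...   | inj₁ z∈V = inj₁ (x∈p∪q⁺ (inj₂ z∈V))
  ...   | inj₂ z∈W = inj₂ z∈W

  ∈-support⇒waypoint : ∀ {a b k} (W : Walk G a b k) {z} → z ∈ support W → ∃ (Waypoint a b k z)
  ∈-support⇒waypoint {a} here z∈ rewrite x∈⁅y⁆⇒x≡y a z∈ = 0 , waypoint here here refl
  ∈-support⇒waypoint {a} (step e W) z∈ with x∈p∪q⁻ ⁅ a ⁆ (support W) z∈
  ... | inj₁ z∈a rewrite x∈⁅y⁆⇒x≡y a z∈a = 0 , waypoint here (step e W) refl
  ... | inj₂ z∈W with ∈-support⇒waypoint W z∈W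
  ...   | i , waypoint V₁ V₂ i+j≡k = suc i , waypoint (step e V₁) V₂ (cong suc i+j≡k)

  WalkIn-start∈ : ∀ {S a b k} → WalkIn G S a b k → a ∈ S
  WalkIn-start∈ (here a∈)     = a∈
  WalkIn-start∈ (step a∈ _ _) = a∈

  WalkIn-end∈ : ∀ {S a b k} → WalkIn G S a b k → b ∈ S
  WalkIn-end∈ (here b∈)    = b∈
  WalkIn-end∈ (step _ _ W) = WalkIn-end∈ W

  WalkIn-mono : ∀ {S T a b k} → S ⊆ T → WalkIn G S a b k → WalkIn G T a b k
  WalkIn-mono S⊆T (here a∈)     = here (S⊆T a∈)
  WalkIn-mono S⊆T (step a∈ e W) = step (S⊆T a∈) e (WalkIn-mono S⊆T W)

  _∷ʳIn_ : ∀ {S a b c k} → WalkIn G S a b k → Adj b c × c ∈ S → WalkIn G S a c (suc k)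
  here a∈       ∷ʳIn (e , c∈) = step a∈ e (here c∈)
  step a∈ e′ W ∷ʳIn ec      = step a∈ e′ (W ∷ʳIn ec)

  reverseIn : ∀ {S a b k} → WalkIn G S a b k → WalkIn G S b a k
  reverseIn (here a∈)     = here a∈
  reverseIn (step a∈ e W) = reverseIn W ∷ʳIn (Adj-sym e , a∈)

  _++In_ : ∀ {S a b c k m} → WalkIn G S a b k → WalkIn G S b c m → WalkIn G S a c (k + m)
  here _       ++In W = W
  step a∈ e V ++In W = step a∈ e (V ++In W)

  walk-in-support : ∀ {a b k} (W : Walk G a b k) → WalkIn G (support W) a b k
  walk-in-support {a} here       = here (x∈⁅x⁆ a)
  walk-in-support (step e W) =
    step (start∈support (step e W)) e (WalkIn-mono (q⊆p∪q _ _) (walk-in-support W))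

  reachable-in-support : ∀ {a b k} (W : Walk G a b k) {z} →
    z ∈ support W → ∃ λ m → WalkIn G (support W) a z m
  reachable-in-support {a} here z∈ rewrite x∈⁅y⁆⇒x≡y a z∈ = 0 , here (x∈⁅x⁆ a)
  reachable-in-support {a} (step e W) z∈ with x∈p∪q⁻ ⁅ a ⁆ (support W) z∈
  ... | inj₁ z∈a rewrite x∈⁅y⁆⇒x≡y a z∈a = 0 , here (start∈support (step e W))
  ... | inj₂ z∈W with reachable-in-support W z∈W
  ...   | m , V = suc m , step (start∈support (step e W)) e (WalkIn-mono (q⊆p∪q _ _) V)

  support-connected : ∀ {a b k} (W : Walk G a b k) → ConnectedIn G (support W)
  support-connected W c d c∈ d∈ with reachable-in-support W c∈ | reachable-in-support W d∈
  ... | k , V | m , U = k + m , reverseIn V ++In U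

  detour-bound : ∀ {s t w w′ D i e i′ j′} o o′ → IsDist G s t D → o + D ≡ o′ + (i′ + j′) →
    Walk G s w i → Walk G w w′ e → Walk G w′ t j′ → o′ + i′ ≤ o + i + e
  detour-bound {D = D} {i} {e} {i′} {j′} o o′ st eq sw ww′ w′t = +-cancelʳ-≤ j′ _ _ (begin
    o′ + i′ + j′       ≡⟨ +-assoc o′ i′ j′ ⟩
    o′ + (i′ + j′)     ≡⟨ sym eq ⟩
    o + D              ≤⟨ +-monoʳ-≤ o (proj₂ st _ (sw ++ ww′ ++ w′t)) ⟩
    o + (i + (e + j′)) ≡⟨ solve (o ∷ i ∷ e ∷ j′ ∷ []) ⟩
    o + i + e + j′     ∎)
    where open ≤-Reasoning

module _ {n : ℕ} (G : Graph n) (S : Subset n) (Φ : Fin n → ℕ → Set)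
  (Φ-total : ∀ {w} → w ∈ S → ∃ (Φ w))
  (Φ-lipschitz : ∀ {w w′ e p p′} → Walk G w w′ e → e ≤ 1 → Φ w p → Φ w′ p′ → p′ ≤ p + e)
  where
  open Walks G

  potential-bound : ∀ {w z m p q} → WalkIn G S w z m → Φ w p → Φ z q → q ≤ p + m
  potential-bound (here _) φw φz = Φ-lipschitz here z≤n φw φz
  potential-bound {p = p} {q} (step {k = m} _ e W) φw φz with Φ-total (WalkIn-start∈ W)
  ... | p₁ , φ₁ = begin
    q           ≤⟨ potential-bound W φ₁ φz ⟩
    p₁ + m      ≤⟨ +-monoˡ-≤ m (Φ-lipschitz (step e here) (s≤s z≤n) φw φ₁) ⟩
    p + 1 + m   ≡⟨ +-assoc p 1 m ⟩
    p + suc m   ∎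
    where open ≤-Reasoning

module Concatenation {n : ℕ} (G : Graph n) {x v u y : Fin n} {a b c : ℕ}
  (xv : IsDist G x v a) (xu : IsDist G x u (a + b)) (vu : IsDist G v u b)
  (vy : IsDist G v y (b + c)) (uy : IsDist G u y c) (2≤b : 2 ≤ b) where
  open Walks G

  data Position (w : Fin n) : ℕ → Set where
    onP : ∀ {i} → Waypoint x v a w i → Position w i
    onQ : ∀ {i} → Waypoint v u b w i → Position w (a + i)
    onR : ∀ {i} → Waypoint u y c w i → Position w (a + b + i)

  no-shortcut-P→R : ∀ {w w′ e i i′} → Walk G w w′ e → e ≤ 1 →
    Waypoint x v a w i → Waypoint u y c w′ i′ → ⊥
  no-shortcut-P→R {e = e} {i} {i′} E e≤1 (waypoint {j} xw wv refl) (waypoint {j′} uw′ w′y refl) =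
    <⇒≱ 2e<2b 2b≤2e
    where
    via-w : i + j + b ≤ i + (e + i′)
    via-w = proj₂ xu _ (xw ++ E ++ reverse uw′)
    via-w′ : b + (i′ + j′) ≤ j + (e + j′)
    via-w′ = proj₂ vy _ (reverse wv ++ E ++ w′y)
    sum-of-detours : b + b + (i + j + i′ + j′) ≤ e + e + (i + j + i′ + j′)
    sum-of-detours = begin
      b + b + (i + j + i′ + j′)            ≡⟨ solve (b ∷ i ∷ j ∷ i′ ∷ j′ ∷ []) ⟩
      i + j + b + (b + (i′ + j′))          ≤⟨ +-mono-≤ via-w via-w′ ⟩
      i + (e + i′) + (j + (e + j′))        ≡⟨ solve (e ∷ i ∷ j ∷ i′ ∷ j′ ∷ []) ⟩
      e + e + (i + j + i′ + j′)            ∎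
      where open ≤-Reasoning
    2b≤2e : b + b ≤ e + e
    2b≤2e = +-cancelʳ-≤ _ _ _ sum-of-detours
    2e<2b : e + e < b + b
    2e<2b = ≤-trans (s≤s (+-mono-≤ e≤1 e≤1)) (≤-trans (n≤1+n 3) (+-mono-≤ 2≤b 2≤b))

  position-lipschitz : ∀ {w w′ e p p′} → Walk G w w′ e → e ≤ 1 →
    Position w p → Position w′ p′ → p′ ≤ p + e
  position-lipschitz E _ (onP (waypoint xw _ _)) (onP (waypoint _ w′v i+j≡a)) =
    detour-bound 0 0 xv (sym i+j≡a) xw E w′v
  position-lipschitz E _ (onP (waypoint xw _ _)) (onQ (waypoint _ w′u i+j≡b)) =
    detour-bound 0 a xu (cong (a +_) (sym i+j≡b)) xw E w′u
  position-lipschitz E e≤1 (onP Ww) (onR Ww′) = ⊥-elim (no-shortcut-P→R E e≤1 Ww Ww′)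
  position-lipschitz {e = e} _ _ (onQ {i} _) (onP Ww′) =
    m≤n⇒m≤n+o e (m≤n⇒m≤n+o i (waypoint-≤ Ww′))
  position-lipschitz E _ (onQ (waypoint vw _ _)) (onQ (waypoint _ w′u i+j≡b)) =
    detour-bound a a vu (cong (a +_) (sym i+j≡b)) vw E w′u
  position-lipschitz E _ (onQ (waypoint vw _ _)) (onR (waypoint _ w′y i+j≡c)) =
    detour-bound a (a + b) vy (trans (cong (λ k → a + (b + k)) (sym i+j≡c)) (sym (+-assoc a b _)))
      vw E w′y
  position-lipschitz {e = e} _ _ (onR {i} _) (onP Ww′) =
    m≤n⇒m≤n+o e (m≤n⇒m≤n+o i (m≤n⇒m≤n+o b (waypoint-≤ Ww′)))
  position-lipschitz {e = e} _ _ (onR {i} _) (onQ Ww′) =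
    m≤n⇒m≤n+o e (m≤n⇒m≤n+o i (+-monoʳ-≤ a (waypoint-≤ Ww′)))
  position-lipschitz E _ (onR (waypoint uw _ _)) (onR (waypoint _ w′y i+j≡c)) =
    detour-bound (a + b) (a + b) uy (cong (a + b +_) (sym i+j≡c)) uw E w′y

  PQR : Walk G x y (a + (b + c))
  PQR = proj₁ xv ++ proj₁ vu ++ proj₁ uy

  position-total : ∀ {w} → w ∈ support PQR → ∃ (Position w)
  position-total w∈ with ∈-support-++ (proj₁ xv) _ w∈
  ... | inj₁ w∈P with ∈-support⇒waypoint (proj₁ xv) w∈P
  ...   | i , Ww = i , onP Ww
  position-total w∈ | inj₂ w∈QR with ∈-support-++ (proj₁ vu) (proj₁ uy) w∈QR
  ... | inj₁ w∈Q with ∈-support⇒waypoint (proj₁ vu) w∈Q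
  ...   | i , Ww = a + i , onQ Ww
  position-total w∈ | inj₂ w∈QR | inj₂ w∈R with ∈-support⇒waypoint (proj₁ uy) w∈R
  ...   | i , Ww = a + b + i , onR Ww

  PQR-shortest-in-support : ∀ m → WalkIn G (support PQR) x y m → a + (b + c) ≤ m
  PQR-shortest-in-support m W = subst (_≤ m) (+-assoc a b c)
    (potential-bound G (support PQR) Position position-total position-lipschitz W
      (onP (waypoint here (proj₁ xv) refl)) (onR (waypoint (proj₁ uy) here (+-identityʳ c))))

  PQR-isDist : DistanceHereditary G → IsDist G x y (a + (b + c))
  PQR-isDist dh = dh (support PQR) (support-connected PQR) x y _
    (WalkIn-start∈ PQR-in) (WalkIn-end∈ PQR-in) (PQR-in , PQR-shortest-in-support)
    where
    PQR-in : WalkIn G (support PQR) x y (a + (b + c))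
    PQR-in = walk-in-support PQR

corollary2 : ∀ {n} (G : Graph n) → Connected G → DistanceHereditary G →
    ∀ (x y v u : Fin n) →
    InInterval G x u v → InInterval G y v u →
    (∃ λ k → IsDist G u v k × 1 < k) →
    ∀ dxy dxv dvu duy →
    IsDist G x y dxy → IsDist G x v dxv → IsDist G v u dvu → IsDist G u y duy →
    dxy ≡ dxv + dvu + duy
corollary2 G _ dh x y v u v∈I[x,u] u∈I[y,v] (k , uv , 1<k) dxy dxv dvu duy xy xv vu uy =
  begin
    dxy               ≡⟨ IsDist-unique xy (PQR-isDist dh) ⟩
    dxv + (dvu + duy) ≡⟨ sym (+-assoc dxv dvu duy) ⟩
    dxv + dvu + duy   ∎
  where
  open ≡-Reasoning
  open Walks G
  xu : IsDist G x u (dxv + dvu)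
  xu = interval-dist v∈I[x,u] xv vu
  vy : IsDist G v y (dvu + duy)
  vy = subst (IsDist G v y) (+-comm duy dvu)
    (IsDist-sym (interval-dist u∈I[y,v] (IsDist-sym uy) (IsDist-sym vu)))
  2≤dvu : 2 ≤ dvu
  2≤dvu = subst (2 ≤_) (IsDist-unique (IsDist-sym uv) vu) 1<k
  open Concatenation G xv xu vu vy uy 2≤dvu
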